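{- Let $\Gamma$ be a global context all of whose rewrite rules satisfy the encoding conditions. The congruence generated by $\to_{\beta\Gamma\beta}$ is equal to $\equiv_{\beta\Gamma}$.
   Context: $\lambda\Pi$-terms (untyped): objects $t ::= x \mid c \mid t\,t \mid \lambda x:U.t$; types $U,V ::= C \mid U\,t \mid \lambda x:U.V \mid \Pi x:U.V$; kinds $K ::= \mathrm{Type}\mid\Pi x:U.K$; a term is an object, type, kind or $\mathrm{Kind}$. A global context contains declarations and rewrite rules $(u\to v)$ (pairs of objects or of types). $\to_\beta$: least relation containing $(\lambda x:A.u)v\to u[x/v]$, closed under subterms; $\to_\Gamma$: least relation containing the rules of $\Gamma$, closed under arbitrary substitution and subterms; $\equiv_{\beta\Gamma}$: the congruence (reflexive–symmetric–transitive closure) generated by $\to_\beta\cup\to_\Gamma$. HRS: simple types over base type $\mathtt{term}$; $\mathtt{term}^1=\mathtt{term}$, $\mathtt{term}^{n+1}=\mathtt{term}\to\mathtt{term}^n$. Signature: $\mathtt{Type},\mathtt{Kind}:\mathtt{term}$, $\mathtt{app}:\mathtt{term}\to\mathtt{term}\to\mathtt{term}$, $\mathtt{lam},\mathtt{pi}:\mathtt{term}\to(\mathtt{term}\to\mathtt{term})\to\mathtt{term}$, $\mathtt{c}:\mathtt{term}$ per constant $c$. HRS-terms: simply typed $\lambda$-terms ($t(u)$, $\underline\lambda x.t$) in long $\beta\eta$-normal form; $\Downarrow t$ long $\beta\eta$-normal form. Pattern: every free occurrence of a variable $F$ is in a subterm $F(u_1,\dots,u_n)$ with the $u_i$ $\eta$-equivalent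 to distinct bound variables. HRS rule $(l\to r)$: same base type, $l$ a pattern not $\eta$-equivalent to a variable, $FV(r)\subseteq FV(l)$. $\to_R$: least relation closed under subterms with $\Downarrow\sigma(l)\to_R\Downarrow\sigma(r)$ for each rule and well-typed substitution $\sigma$. Encoding $[\![\cdot]\!]$: $[\![\mathrm{Kind}]\!]=\mathtt{Kind}$, $[\![\mathrm{Type}]\!]=\mathtt{Type}$, $[\![x]\!]=x:\mathtt{term}$, $[\![c]\!]=\mathtt{c}$, $[\![uv]\!]=\mathtt{app}([\![u]\!],[\![v]\!])$, $[\![\lambda x:A.t]\!]=\mathtt{lam}([\![A]\!],\underline\lambda x.[\![t]\!])$, $[\![\Pi x:A.B]\!]=\mathtt{pi}([\![A]\!],\underline\lambda x.[\![B]\!])$. For $t$ uniform in $V$ (all occurrences of each free variable of $t$ not in $V$ applied to the same number of arguments), $[\![t]\!]_V$: identical on sorts and constants, $[\![x]\!]_V=x$ if $x\in V$, $[\![\lambda x:A.u]\!]_V=\mathtt{lam}([\![A]\!]_V,\underline\lambda x.[\![u]\!]_{V\cup\{x\}})$, $[\![\Pi x:A.B]\!]_V=\mathtt{pi}([\![A]\!]_V,\underline\lambda x.[\![B]\!]_{V\cup\{x\}})$, $[\![x\,v_1\dots v_n]\!]_V=x([\![v_1]\!]_V,\dots,[\![v_n]\!]_V)$ for $x\notin V$ ($x:\mathtt{term}^{n+1}$), $[\![uv]\!]_V=\mathtt{app}([\![u]\!]_V,[\![v]\!]_V)$ otherwise. $\lambda\Pi$-patterns: for $V=(V_0,\mathcal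 A)$ ($\mathcal A$ arity function), $\mathcal P_V$ is least with: constants; $pq$ for $p,q\in\mathcal P_V$; $x\in V_0$; $p\,(x\vec y)$ for $p\in\mathcal P_V$, $x\notin V_0$, $\vec y$ pairwise distinct in $V_0$ with $|\vec y|=\mathcal A(x)$; $p\,(\lambda x:A.q)$ for $p\in\mathcal P_V$, $FV(A)\subseteq V_0$, $q\in\mathcal P_{(V_0\cup\{x\},\mathcal A)}$. A $\lambda\Pi$-pattern is an element of some $\mathcal P_{(\emptyset,\mathcal A)}$. Encoding conditions on $(u\to v)$: $u$ a $\lambda\Pi$-pattern, $FV(v)\subseteq FV(u)$, every free variable applied to the same number of arguments at all its occurrences in $u$ and $v$; $[\![u\to v]\!]=([\![u]\!]_\emptyset\to[\![v]\!]_\emptyset)$. $\mathrm{HRS}(\beta\Gamma)=\{[\![u\to v]\!]:(u\to v)\in\Gamma\}\cup\{\mathtt{app}(\mathtt{lam}(X,\underline\lambda x.Y(x)),Z)\to Y(Z)\}$. $t_1\to_{\beta\Gamma\beta}t_2$ iff $[\![t_1]\!]\to_{\mathrm{HRS}(\beta\Gamma)}[\![t_2]\!]$. -}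

module Defs where

open import Data.Nat using (ℕ; zero; suc; _+_)
open import Data.Fin using (Fin; zero; suc; _↑ˡ_; _↑ʳ_; splitAt)
open import Data.Vec using (Vec; []; _∷_; lookup; map)
open import Data.List using (List)
open import Data.List.Membership.Propositional using (_∈_)
open import Data.Product using (Σ; _×_; _,_)
open import Data.Sum using (_⊎_; inj₁; inj₂; [_,_]′)
open import Relation.Nullary using (¬_)
open import Relation.Binary.PropositionalEquality using (_≡_)
open import Relation.Binary.Core using (Rel)
import Level
open import Relation.Binary.Construct.Closure.Equivalence using (EqClosure)

Const : Set
Const = ℕ

data Term (n : ℕ) : Set where
  var  : Fin n → Term n
  con  : Const → Term n
  Type : Term n
  Kind : Term n
  app  : Term n → Term n → Term n
  lam  : Term n → Term (suc n) → Term n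
  pi   : Term n → Term (suc n) → Term n

extR : ∀ {m n} → (Fin m → Fin n) → Fin (suc m) → Fin (suc n)
extR ρ zero    = zero
extR ρ (suc i) = suc (ρ i)

ren : ∀ {m n} → (Fin m → Fin n) → Term m → Term n
ren ρ (var i)   = var (ρ i)
ren ρ (con c)   = con c
ren ρ Type      = Type
ren ρ Kind      = Kind
ren ρ (app t u) = app (ren ρ t) (ren ρ u)
ren ρ (lam A t) = lam (ren ρ A) (ren (extR ρ) t)
ren ρ (pi A B)  = pi (ren ρ A) (ren (extR ρ) B)

extS : ∀ {m n} → (Fin m → Term n) → Fin (suc m) → Term (suc n)
extS σ zero    = var zero
extS σ (suc i) = ren suc (σ i)

sub : ∀ {m n} → (Fin m → Term n) → Term m → Term n
sub σ (var i)   = σ i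
sub σ (con c)   = con c
sub σ Type      = Type
sub σ Kind      = Kind
sub σ (app t u) = app (sub σ t) (sub σ u)
sub σ (lam A t) = lam (sub σ A) (sub (extS σ) t)
sub σ (pi A B)  = pi (sub σ A) (sub (extS σ) B)

sub0 : ∀ {n} → Term (suc n) → Term n → Term n
sub0 {n} u v = sub σ u
  where
  σ : Fin (suc n) → Term n
  σ zero    = v
  σ (suc i) = var i

-- Global contexts: only the rewrite rules matter.  A rule u → v has k
-- free variables (the variables of the rule), u v : Term k.

record Rule : Set where
  field
    k   : ℕ
    lhs : Term k
    rhs : Term k
open Rule public

GlobalContext : Set
GlobalContext = List Rule

data Ctx (R : ∀ {n} → Rel (Term n) Level.zero) : ∀ {n} → Rel (Term n) Level.zero where
  top  : ∀ {n} {t u : Term n} → R t u → Ctx R t u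
  appL : ∀ {n} {t t' u : Term n} → Ctx R t t' → Ctx R (app t u) (app t' u)
  appR : ∀ {n} {t u u' : Term n} → Ctx R u u' → Ctx R (app t u) (app t u')
  lamL : ∀ {n} {A A' : Term n} {t} → Ctx R A A' → Ctx R (lam A t) (lam A' t)
  lamR : ∀ {n} {A : Term n} {t t'} → Ctx R t t' → Ctx R (lam A t) (lam A t')
  piL  : ∀ {n} {A A' : Term n} {B} → Ctx R A A' → Ctx R (pi A B) (pi A' B)
  piR  : ∀ {n} {A : Term n} {B B'} → Ctx R B B' → Ctx R (pi A B) (pi A B')

data βTop {n : ℕ} : Rel (Term n) Level.zero where
  beta : ∀ (A : Term n) u v → βTop (app (lam A u) v) (sub0 u v)

data ΓTop (Γ : GlobalContext) {n : ℕ} : Rel (Term n) Level.zero where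
  rule : ∀ {ρ} → ρ ∈ Γ → (σ : Fin (k ρ) → Term n) →
         ΓTop Γ (sub σ (lhs ρ)) (sub σ (rhs ρ))

βΓTop : GlobalContext → ∀ {n} → Rel (Term n) Level.zero
βΓTop Γ t u = βTop t u ⊎ ΓTop Γ t u

StepβΓ : GlobalContext → ∀ {n} → Rel (Term n) Level.zero
StepβΓ Γ = Ctx (βΓTop Γ)

_⊢_≡βΓ_ : GlobalContext → ∀ {n} → Rel (Term n) Level.zero
Γ ⊢ t ≡βΓ u = EqClosure (StepβΓ Γ) t u

apps : ∀ {m j} → Term m → Vec (Term m) j → Term m
apps h []       = h
apps h (v ∷ vs) = apps (app h v) vs

headT : ∀ {m} → Term m → Term m
headT (app t u) = headT t
headT t         = t

data FreeIn {m : ℕ} : Fin m → Term m → Set where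
  f-var  : ∀ x → FreeIn x (var x)
  f-appL : ∀ {x t u} → FreeIn x t → FreeIn x (app t u)
  f-appR : ∀ {x t u} → FreeIn x u → FreeIn x (app t u)
  f-lamL : ∀ {x A t} → FreeIn x A → FreeIn x (lam A t)
  f-lamR : ∀ {x A t} → FreeIn (suc x) t → FreeIn x (lam A t)
  f-piL  : ∀ {x A B} → FreeIn x A → FreeIn x (pi A B)
  f-piR  : ∀ {x A B} → FreeIn (suc x) B → FreeIn x (pi A B)

-- Convention for [[t]]_V inside a rule with k variables: a term under d
-- binders lives in Term (d + k); the indices (i ↑ˡ k) (i : Fin d) are
-- the bound variables (the set V), the indices (d ↑ʳ x) (x : Fin k) are
-- the free variables of the rule (those not in V).

FreeHead : ∀ {k} d → Term (d + k) → Set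
FreeHead {k} d t = Σ (Fin k) λ x → headT t ≡ var ((d ↑ʳ x))

Distinct : ∀ {d j} → Vec (Fin d) j → Set
Distinct ys = ∀ i j → lookup ys i ≡ lookup ys j → i ≡ j

-- t is uniform in V w.r.t. the arity function ar: every occurrence of a
-- free variable x not in V is applied to exactly ar x arguments
-- (i.e. it is the head of a maximal spine of length ar x).
data Uniform {k} (ar : Fin k → ℕ) : (d : ℕ) → Term (d + k) → Set
data UniformVec {k} (ar : Fin k → ℕ) (d : ℕ) : ∀ {j} → Vec (Term (d + k)) j → Set

data Uniform {k} ar where
  u-var  : ∀ {d} (i : Fin d) → Uniform ar d (var ((i ↑ˡ k)))
  u-con  : ∀ {d} c → Uniform ar d (con c)
  u-Type : ∀ {d} → Uniform ar d Type
  u-Kind : ∀ {d} → Uniform ar d Kind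
  u-fv   : ∀ {d} (x : Fin k) {vs : Vec (Term (d + k)) (ar x)} →
           UniformVec ar d vs → Uniform ar d (apps (var ((d ↑ʳ x))) vs)
  u-app  : ∀ {d t u} → ¬ FreeHead d (app t u) →
           Uniform ar d t → Uniform ar d u → Uniform ar d (app t u)
  u-lam  : ∀ {d A t} → Uniform ar d A → Uniform ar (suc d) t → Uniform ar d (lam A t)
  u-pi   : ∀ {d A B} → Uniform ar d A → Uniform ar (suc d) B → Uniform ar d (pi A B)

data UniformVec {k} ar d where
  []  : UniformVec ar d []
  _∷_ : ∀ {j t} {ts : Vec _ j} → Uniform ar d t → UniformVec ar d ts → UniformVec ar d (t ∷ ts)

data IsPat {k} (ar : Fin k → ℕ) : (d : ℕ) → Term (d + k) → Set where
  p-con : ∀ {d} c → IsPat ar d (con c)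
  p-app : ∀ {d p q} → IsPat ar d p → IsPat ar d q → IsPat ar d (app p q)
  p-var : ∀ {d} (i : Fin d) → IsPat ar d (var ((i ↑ˡ k)))
  p-fv  : ∀ {d p} → IsPat ar d p → (x : Fin k) (ys : Vec (Fin d) (ar x)) → Distinct ys →
          IsPat ar d (app p (apps (var ((d ↑ʳ x))) (map (λ y → var ((y ↑ˡ k))) ys)))
  p-lam : ∀ {d p q} → IsPat ar d p → (A : Term (d + k)) →
          (∀ (x : Fin k) → ¬ FreeIn ((d ↑ʳ x)) A) → IsPat ar (suc d) q →
          IsPat ar d (app p (lam A q))

record EncCondAt (ρ : Rule) (ar : Fin (k ρ) → ℕ) : Set where
  field
    isPat   : IsPat ar 0 (lhs ρ)
    fv⊆     : ∀ x → FreeIn x (rhs ρ) → FreeIn x (lhs ρ)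
    unifL   : Uniform ar 0 (lhs ρ)
    unifR   : Uniform ar 0 (rhs ρ)
open EncCondAt public

EncCond : Rule → Set
EncCond ρ = Σ (Fin (k ρ) → ℕ) λ ar → EncCondAt ρ ar

-- HRS terms (long βη-normal forms) over the signature
-- Type, Kind, app, lam, pi, c.  All bound variables have type term, so a
-- long βη-normal form is first-order except for free higher-order
-- variables: HTerm ar n has free variables x : Fin k of type
-- term^(ar x + 1) (always fully applied, hmeta x args) and n free/bound
-- variables of type term (hvar).  lam/pi take the body λx.B as B in scope
-- suc n.

data HTerm {k} (ar : Fin k → ℕ) (n : ℕ) : Set where
  hvar  : Fin n → HTerm ar n
  hmeta : (x : Fin k) → Vec (HTerm ar n) (ar x) → HTerm ar n
  hcon  : Const → HTerm ar n
  hType : HTerm ar n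
  hKind : HTerm ar n
  happ  : HTerm ar n → HTerm ar n → HTerm ar n
  hlam  : HTerm ar n → HTerm ar (suc n) → HTerm ar n
  hpi   : HTerm ar n → HTerm ar (suc n) → HTerm ar n

noMeta : Fin 0 → ℕ
noMeta ()

HTerm₀ : ℕ → Set
HTerm₀ = HTerm noMeta

hren : ∀ {m n} → (Fin m → Fin n) → HTerm₀ m → HTerm₀ n
hren ρ (hvar i)    = hvar (ρ i)
hren ρ (hmeta () _)
hren ρ (hcon c)    = hcon c
hren ρ hType       = hType
hren ρ hKind       = hKind
hren ρ (happ t u)  = happ (hren ρ t) (hren ρ u)
hren ρ (hlam A t)  = hlam (hren ρ A) (hren (extR ρ) t)
hren ρ (hpi A B)   = hpi (hren ρ A) (hren (extR ρ) B)

hextS : ∀ {m n} → (Fin m → HTerm₀ n) → Fin (suc m) → HTerm₀ (suc n)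
hextS σ zero    = hvar zero
hextS σ (suc i) = hren suc (σ i)

-- substitution of base-type terms for base-type variables: the result of
-- substituting into a long βη-normal form is again long βη-normal.
hsub : ∀ {m n} → (Fin m → HTerm₀ n) → HTerm₀ m → HTerm₀ n
hsub σ (hvar i)    = σ i
hsub σ (hmeta () _)
hsub σ (hcon c)    = hcon c
hsub σ hType       = hType
hsub σ hKind       = hKind
hsub σ (happ t u)  = happ (hsub σ t) (hsub σ u)
hsub σ (hlam A t)  = hlam (hsub σ A) (hsub (hextS σ) t)
hsub σ (hpi A B)   = hpi (hsub σ A) (hsub (hextS σ) B)

-- A well-typed HRS substitution for the higher-order variables of a rule,
-- into an ambient scope of n variables of type term:  σ x  represents the
-- long normal form  λy_1…y_(ar x). N  as N : HTerm₀ (ar x + n), the index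
-- (j ↑ˡ n) standing for the j-th abstracted argument.
HSubst : ∀ {k} → (Fin k → ℕ) → ℕ → Set
HSubst {k} ar n = (x : Fin k) → HTerm₀ (ar x + n)

inst    : ∀ {k} {ar : Fin k → ℕ} {n d} → HSubst ar n → HTerm ar d → HTerm₀ (d + n)
instVec : ∀ {k} {ar : Fin k → ℕ} {n d j} → HSubst ar n → Vec (HTerm ar d) j → Vec (HTerm₀ (d + n)) j

inst {n = n} {d = d} σ (hvar i) = hvar ((i ↑ˡ n))
inst {ar = ar} {n = n} {d = d} σ (hmeta x args) = hsub τ (σ x)
  where
  as : Vec (HTerm₀ (d + n)) (ar x)
  as = instVec σ args
  τ : Fin (ar x + n) → HTerm₀ (d + n)
  τ i = [ (λ j → lookup as j) , (λ y → hvar ((d ↑ʳ y))) ]′ (splitAt (ar x) i)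
inst σ (hcon c)   = hcon c
inst σ hType      = hType
inst σ hKind      = hKind
inst σ (happ t u) = happ (inst σ t) (inst σ u)
inst σ (hlam A t) = hlam (inst σ A) (inst σ t)
inst σ (hpi A B)  = hpi (inst σ A) (inst σ B)

instVec σ []       = []
instVec σ (t ∷ ts) = inst σ t ∷ instVec σ ts

record HRule : Set where
  field
    hk   : ℕ
    har  : Fin hk → ℕ
    hlhs : HTerm har 0
    hrhs : HTerm har 0
open HRule public

data HTop (R : HRule → Set) {n : ℕ} : Rel (HTerm₀ n) Level.zero where
  rule : ∀ {ρ} → R ρ → (σ : HSubst (har ρ) n) → HTop R (inst σ (hlhs ρ)) (inst σ (hrhs ρ))

data HStep (R : HRule → Set) : ∀ {n} → Rel (HTerm₀ n) Level.zero where
  top  : ∀ {n} {t u : HTerm₀ n} → HTop R t u → HStep R t u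
  appL : ∀ {n} {t t' u : HTerm₀ n} → HStep R t t' → HStep R (happ t u) (happ t' u)
  appR : ∀ {n} {t u u' : HTerm₀ n} → HStep R u u' → HStep R (happ t u) (happ t u')
  lamL : ∀ {n} {A A' : HTerm₀ n} {t} → HStep R A A' → HStep R (hlam A t) (hlam A' t)
  lamR : ∀ {n} {A : HTerm₀ n} {t t'} → HStep R t t' → HStep R (hlam A t) (hlam A t')
  piL  : ∀ {n} {A A' : HTerm₀ n} {B} → HStep R A A' → HStep R (hpi A B) (hpi A' B)
  piR  : ∀ {n} {A : HTerm₀ n} {B B'} → HStep R B B' → HStep R (hpi A B) (hpi A B')

enc : ∀ {n} → Term n → HTerm₀ n
enc (var x)   = hvar x
enc (con c)   = hcon c
enc Type      = hType
enc Kind      = hKind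
enc (app t u) = happ (enc t) (enc u)
enc (lam A t) = hlam (enc A) (enc t)
enc (pi A B)  = hpi (enc A) (enc B)

encV    : ∀ {k} {ar : Fin k → ℕ} {d} {t : Term (d + k)} → Uniform ar d t → HTerm ar d
encVVec : ∀ {k} {ar : Fin k → ℕ} {d j} {ts : Vec (Term (d + k)) j} → UniformVec ar d ts → Vec (HTerm ar d) j

encV (u-var i)     = hvar i
encV (u-con c)     = hcon c
encV u-Type        = hType
encV u-Kind        = hKind
encV (u-fv x us)   = hmeta x (encVVec us)
encV (u-app _ p q) = happ (encV p) (encV q)
encV (u-lam p q)   = hlam (encV p) (encV q)
encV (u-pi p q)    = hpi (encV p) (encV q)

encVVec []       = []
encVVec (u ∷ us) = encV u ∷ encVVec us

encRule : (ρ : Rule) (ar : Fin (k ρ) → ℕ) → EncCondAt ρ ar → HRule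
encRule ρ ar c = record { hk = k ρ ; har = ar ; hlhs = encV (unifL c) ; hrhs = encV (unifR c) }

-- app(lam(X, λx.Y(x)), Z) → Y(Z)   with X = 0, Y = 1, Z = 2
βar : Fin 3 → ℕ
βar zero             = 0
βar (suc zero)       = 1
βar (suc (suc zero)) = 0

βHRule : HRule
βHRule = record
  { hk   = 3
  ; har  = βar
  ; hlhs = happ (hlam (hmeta zero []) (hmeta (suc zero) (hvar zero ∷ [])))
                (hmeta (suc (suc zero)) [])
  ; hrhs = hmeta (suc zero) (hmeta (suc (suc zero)) [] ∷ [])
  }

data HRSβΓ (Γ : GlobalContext) : HRule → Set where
  encoded : ∀ {ρ} → ρ ∈ Γ → (ar : Fin (k ρ) → ℕ) (c : EncCondAt ρ ar) → HRSβΓ Γ (encRule ρ ar c)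
  βrule   : HRSβΓ Γ βHRule

StepβΓβ : GlobalContext → ∀ {n} → Rel (Term n) Level.zero
StepβΓβ Γ t₁ t₂ = HStep (HRSβΓ Γ) (enc t₁) (enc t₂)

CongβΓβ : GlobalContext → ∀ {n} → Rel (Term n) Level.zero
CongβΓβ Γ = EqClosure (Ctx (StepβΓβ Γ))

module Submission where

-- Both inclusions compare a λΠ-rule instance θ(l) with an HRS instance
-- ⇓σ([[l]]_∅), read back as a λΠ-term by the decoding dec (inverse to
-- [[_]] and commuting with substitution).  One instantiation lemma does
-- this for both directions: if θ x applied to arguments is R-related to
-- the body of σ x with the arguments plugged in ("θ realises σ"), for a
-- reflexive relation R compatible with the term constructors, then θ(l)
-- is R-related to dec(⇓σ([[l]]_V)) for every l uniform in V.
--  * ≡βΓ ⊆ congruence: R is ≡ and σ the η-expansion x ↦ λy⃗. θ(x) y⃗, so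
--    every βΓ-step is a single HRS(βΓ)-step between the encodings.
--  * congruence ⊆ ≡βΓ: R is ≡βΓ and θ the abstraction x ↦ λy⃗:Type. σ(x),
--    so every HRS(βΓ)-step decodes to a βΓ-conversion; the HRS β-rule is
--    the encoding of the λΠ-rule (λx:X. Y x) Z → Y Z.

open import Defs
open import Data.Nat using (ℕ; zero; suc; _+_)
open import Data.Fin using (Fin; zero; suc; _↑ˡ_; _↑ʳ_; splitAt)
open import Data.Vec using (Vec; []; _∷_; lookup; map; tabulate)
open import Data.Vec.Properties using (lookup-map; tabulate∘lookup; tabulate-cong; tabulate-∘)
open import Data.Vec.Functional using () renaming (_∷_ to _∷ᶠ_; _++_ to _++ᶠ_)
open import Data.Vec.Functional.Properties using (lookup-++ˡ; lookup-++ʳ)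
open import Data.Vec.Relation.Binary.Pointwise.Inductive using (Pointwise; []; _∷_; Pointwise-≡⇒≡)
import Data.Vec.Relation.Binary.Pointwise.Inductive as Pointwise
open import Data.Sum using (inj₁; inj₂; [_,_]′)
open import Data.Sum.Properties using ([,]-∘; [-,]-cong)
open import Data.Product using (_,_)
open import Data.List.Relation.Unary.All using (All)
import Data.List.Relation.Unary.All as All
open import Function.Base using (_∘_)
open import Function.Bundles using (_⇔_; mk⇔)
open import Level using (0ℓ)
open import Relation.Binary.Core using (Rel)
open import Relation.Binary.PropositionalEquality
open import Relation.Binary.Construct.Closure.Equivalence using (gmap; return; symmetric; _⋆)
import Relation.Binary.Construct.Closure.Equivalence as EqClosure
open import Relation.Binary.Construct.Closure.ReflexiveTransitive using (ε; _◅◅_)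
import Relation.Binary.Reasoning.Setoid as SetoidReasoning

-- Substitution algebra of λΠ-terms

extR-cong : ∀ {m n} {r r' : Fin m → Fin n} → (∀ i → r i ≡ r' i) → ∀ i → extR r i ≡ extR r' i
extR-cong e zero    = refl
extR-cong e (suc i) = cong suc (e i)

extS-cong : ∀ {m n} {s s' : Fin m → Term n} → (∀ i → s i ≡ s' i) → ∀ i → extS s i ≡ extS s' i
extS-cong e zero    = refl
extS-cong e (suc i) = cong (ren suc) (e i)

ren-cong : ∀ {m n} {r r' : Fin m → Fin n} → (∀ i → r i ≡ r' i) → ∀ t → ren r t ≡ ren r' t
ren-cong e (var i)   = cong var (e i)
ren-cong e (con c)   = refl
ren-cong e Type      = refl
ren-cong e Kind      = refl
ren-cong e (app t u) = cong₂ app (ren-cong e t) (ren-cong e u)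
ren-cong e (lam A t) = cong₂ lam (ren-cong e A) (ren-cong (extR-cong e) t)
ren-cong e (pi A B)  = cong₂ pi (ren-cong e A) (ren-cong (extR-cong e) B)

sub-cong : ∀ {m n} {s s' : Fin m → Term n} → (∀ i → s i ≡ s' i) → ∀ t → sub s t ≡ sub s' t
sub-cong e (var i)   = e i
sub-cong e (con c)   = refl
sub-cong e Type      = refl
sub-cong e Kind      = refl
sub-cong e (app t u) = cong₂ app (sub-cong e t) (sub-cong e u)
sub-cong e (lam A t) = cong₂ lam (sub-cong e A) (sub-cong (extS-cong e) t)
sub-cong e (pi A B)  = cong₂ pi (sub-cong e A) (sub-cong (extS-cong e) B)

extR-∘ : ∀ {l m n} (r : Fin m → Fin n) (r' : Fin l → Fin m) i → extR r (extR r' i) ≡ extR (r ∘ r') i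
extR-∘ r r' zero    = refl
extR-∘ r r' (suc i) = refl

ren-∘ : ∀ {l m n} (r : Fin m → Fin n) (r' : Fin l → Fin m) t → ren r (ren r' t) ≡ ren (r ∘ r') t
ren-∘ r r' (var i)   = refl
ren-∘ r r' (con c)   = refl
ren-∘ r r' Type      = refl
ren-∘ r r' Kind      = refl
ren-∘ r r' (app t u) = cong₂ app (ren-∘ r r' t) (ren-∘ r r' u)
ren-∘ r r' (lam A t) = cong₂ lam (ren-∘ r r' A) (trans (ren-∘ (extR r) (extR r') t) (ren-cong (extR-∘ r r') t))
ren-∘ r r' (pi A B)  = cong₂ pi (ren-∘ r r' A) (trans (ren-∘ (extR r) (extR r') B) (ren-cong (extR-∘ r r') B))

extR-extS : ∀ {l m n} (r : Fin m → Fin n) (s : Fin l → Term m) i → ren (extR r) (extS s i) ≡ extS (ren r ∘ s) i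
extR-extS r s zero    = refl
extR-extS r s (suc i) = trans (ren-∘ (extR r) suc (s i)) (sym (ren-∘ suc r (s i)))

ren-sub : ∀ {l m n} (r : Fin m → Fin n) (s : Fin l → Term m) t → ren r (sub s t) ≡ sub (ren r ∘ s) t
ren-sub r s (var i)   = refl
ren-sub r s (con c)   = refl
ren-sub r s Type      = refl
ren-sub r s Kind      = refl
ren-sub r s (app t u) = cong₂ app (ren-sub r s t) (ren-sub r s u)
ren-sub r s (lam A t) = cong₂ lam (ren-sub r s A) (trans (ren-sub (extR r) (extS s) t) (sub-cong (extR-extS r s) t))
ren-sub r s (pi A B)  = cong₂ pi (ren-sub r s A) (trans (ren-sub (extR r) (extS s) B) (sub-cong (extR-extS r s) B))

extS-extR : ∀ {l m n} (s : Fin m → Term n) (r : Fin l → Fin m) i → extS s (extR r i) ≡ extS (s ∘ r) i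
extS-extR s r zero    = refl
extS-extR s r (suc i) = refl

sub-ren : ∀ {l m n} (s : Fin m → Term n) (r : Fin l → Fin m) t → sub s (ren r t) ≡ sub (s ∘ r) t
sub-ren s r (var i)   = refl
sub-ren s r (con c)   = refl
sub-ren s r Type      = refl
sub-ren s r Kind      = refl
sub-ren s r (app t u) = cong₂ app (sub-ren s r t) (sub-ren s r u)
sub-ren s r (lam A t) = cong₂ lam (sub-ren s r A) (trans (sub-ren (extS s) (extR r) t) (sub-cong (extS-extR s r) t))
sub-ren s r (pi A B)  = cong₂ pi (sub-ren s r A) (trans (sub-ren (extS s) (extR r) B) (sub-cong (extS-extR s r) B))

extS-extS : ∀ {l m n} (s : Fin m → Term n) (s' : Fin l → Term m) i → sub (extS s) (extS s' i) ≡ extS (sub s ∘ s') i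
extS-extS s s' zero    = refl
extS-extS s s' (suc i) = trans (sub-ren (extS s) suc (s' i)) (sym (ren-sub suc s (s' i)))

sub-sub : ∀ {l m n} (s : Fin m → Term n) (s' : Fin l → Term m) t → sub s (sub s' t) ≡ sub (sub s ∘ s') t
sub-sub s s' (var i)   = refl
sub-sub s s' (con c)   = refl
sub-sub s s' Type      = refl
sub-sub s s' Kind      = refl
sub-sub s s' (app t u) = cong₂ app (sub-sub s s' t) (sub-sub s s' u)
sub-sub s s' (lam A t) = cong₂ lam (sub-sub s s' A) (trans (sub-sub (extS s) (extS s') t) (sub-cong (extS-extS s s') t))
sub-sub s s' (pi A B)  = cong₂ pi (sub-sub s s' A) (trans (sub-sub (extS s) (extS s') B) (sub-cong (extS-extS s s') B))

extS-var : ∀ {m n} (r : Fin m → Fin n) i → extS (var ∘ r) i ≡ var (extR r i)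
extS-var r zero    = refl
extS-var r (suc i) = refl

sub-var : ∀ {m n} (r : Fin m → Fin n) t → sub (var ∘ r) t ≡ ren r t
sub-var r (var i)   = refl
sub-var r (con c)   = refl
sub-var r Type      = refl
sub-var r Kind      = refl
sub-var r (app t u) = cong₂ app (sub-var r t) (sub-var r u)
sub-var r (lam A t) = cong₂ lam (sub-var r A) (trans (sub-cong (extS-var r) t) (sub-var (extR r) t))
sub-var r (pi A B)  = cong₂ pi (sub-var r A) (trans (sub-cong (extS-var r) B) (sub-var (extR r) B))

extR-id : ∀ {n} {r : Fin n → Fin n} → (∀ i → r i ≡ i) → ∀ i → extR r i ≡ i
extR-id e zero    = refl
extR-id e (suc i) = cong suc (e i)

ren-id : ∀ {n} {r : Fin n → Fin n} → (∀ i → r i ≡ i) → ∀ t → ren r t ≡ t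
ren-id e (var i)   = cong var (e i)
ren-id e (con c)   = refl
ren-id e Type      = refl
ren-id e Kind      = refl
ren-id e (app t u) = cong₂ app (ren-id e t) (ren-id e u)
ren-id e (lam A t) = cong₂ lam (ren-id e A) (ren-id (extR-id e) t)
ren-id e (pi A B)  = cong₂ pi (ren-id e A) (ren-id (extR-id e) B)

sub-id : ∀ {n} {s : Fin n → Term n} → (∀ i → s i ≡ var i) → ∀ t → sub s t ≡ t
sub-id e t = trans (sub-cong e t) (trans (sub-var (λ i → i) t) (ren-id (λ _ → refl) t))

sub0-extS : ∀ {m n} (ρ : Fin m → Term n) t w → sub0 (sub (extS ρ) t) w ≡ sub (w ∷ᶠ ρ) t
sub0-extS ρ t w = trans (sub-sub _ (extS ρ) t) (sub-cong extend t)
  where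
  extend : ∀ i → sub0 (extS ρ i) w ≡ (w ∷ᶠ ρ) i
  extend zero    = refl
  extend (suc i) = trans (sub-ren _ suc (ρ i)) (sub-id (λ _ → refl) (ρ i))

sub-apps : ∀ {m n j} (s : Fin m → Term n) h (vs : Vec (Term m) j) → sub s (apps h vs) ≡ apps (sub s h) (map (sub s) vs)
sub-apps s h []       = refl
sub-apps s h (v ∷ vs) = sub-apps s (app h v) vs

record Compatible (R : ∀ {n} → Rel (Term n) 0ℓ) : Set where
  field
    reflexive : ∀ {n} {t u : Term n} → t ≡ u → R t u
    app-cong  : ∀ {n} {t t' u u' : Term n} → R t t' → R u u' → R (app t u) (app t' u')
    lam-cong  : ∀ {n} {A A' : Term n} {t t'} → R A A' → R t t' → R (lam A t) (lam A' t')
    pi-cong   : ∀ {n} {A A' : Term n} {B B'} → R A A' → R B B' → R (pi A B) (pi A' B')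

  apps-cong : ∀ {n j} {h h' : Term n} {vs ws : Vec (Term n) j} →
              R h h' → Pointwise R vs ws → R (apps h vs) (apps h' ws)
  apps-cong p []       = p
  apps-cong p (q ∷ qs) = apps-cong (app-cong p q) qs

≡-compatible : Compatible _≡_
≡-compatible = record
  { reflexive = λ e → e
  ; app-cong  = cong₂ app
  ; lam-cong  = cong₂ lam
  ; pi-cong   = cong₂ pi
  }

dec : ∀ {n} → HTerm₀ n → Term n
dec (hvar i)     = var i
dec (hmeta () _)
dec (hcon c)     = con c
dec hType        = Type
dec hKind        = Kind
dec (happ t u)   = app (dec t) (dec u)
dec (hlam A t)   = lam (dec A) (dec t)
dec (hpi A B)    = pi (dec A) (dec B)

dec-enc : ∀ {n} (t : Term n) → dec (enc t) ≡ t
dec-enc (var i)   = refl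
dec-enc (con c)   = refl
dec-enc Type      = refl
dec-enc Kind      = refl
dec-enc (app t u) = cong₂ app (dec-enc t) (dec-enc u)
dec-enc (lam A t) = cong₂ lam (dec-enc A) (dec-enc t)
dec-enc (pi A B)  = cong₂ pi (dec-enc A) (dec-enc B)

enc-dec : ∀ {n} (h : HTerm₀ n) → enc (dec h) ≡ h
enc-dec (hvar i)     = refl
enc-dec (hmeta () _)
enc-dec (hcon c)     = refl
enc-dec hType        = refl
enc-dec hKind        = refl
enc-dec (happ t u)   = cong₂ happ (enc-dec t) (enc-dec u)
enc-dec (hlam A t)   = cong₂ hlam (enc-dec A) (enc-dec t)
enc-dec (hpi A B)    = cong₂ hpi (enc-dec A) (enc-dec B)

enc-from-dec : ∀ {n} {h : HTerm₀ n} {t : Term n} → dec h ≡ t → h ≡ enc t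
enc-from-dec {h = h} e = trans (sym (enc-dec h)) (cong enc e)

dec-hren : ∀ {m n} (r : Fin m → Fin n) h → dec (hren r h) ≡ ren r (dec h)
dec-hren r (hvar i)     = refl
dec-hren r (hmeta () _)
dec-hren r (hcon c)     = refl
dec-hren r hType        = refl
dec-hren r hKind        = refl
dec-hren r (happ t u)   = cong₂ app (dec-hren r t) (dec-hren r u)
dec-hren r (hlam A t)   = cong₂ lam (dec-hren r A) (dec-hren (extR r) t)
dec-hren r (hpi A B)    = cong₂ pi (dec-hren r A) (dec-hren (extR r) B)

dec-hextS : ∀ {m n} (s : Fin m → HTerm₀ n) i → dec (hextS s i) ≡ extS (dec ∘ s) i
dec-hextS s zero    = refl
dec-hextS s (suc i) = dec-hren suc (s i)

dec-hsub : ∀ {m n} (s : Fin m → HTerm₀ n) h → dec (hsub s h) ≡ sub (dec ∘ s) (dec h)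
dec-hsub s (hvar i)     = refl
dec-hsub s (hmeta () _)
dec-hsub s (hcon c)     = refl
dec-hsub s hType        = refl
dec-hsub s hKind        = refl
dec-hsub s (happ t u)   = cong₂ app (dec-hsub s t) (dec-hsub s u)
dec-hsub s (hlam A t)   = cong₂ lam (dec-hsub s A) (trans (dec-hsub (hextS s) t) (sub-cong (dec-hextS s) (dec t)))
dec-hsub s (hpi A B)    = cong₂ pi (dec-hsub s A) (trans (dec-hsub (hextS s) B) (sub-cong (dec-hextS s) (dec B)))

-- The arguments ws plugged in for the j abstracted variables of the body of
-- an HRS substitution, the ambient variables being shifted past d binders.
plug : ∀ {n j} d → Vec (Term (d + n)) j → Fin (j + n) → Term (d + n)
plug d ws = lookup ws ++ᶠ (λ y → var (d ↑ʳ y))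

dec-inst-meta : ∀ {k} {ar : Fin k → ℕ} {n d} (σ : HSubst ar n) x (args : Vec (HTerm ar d) (ar x)) →
                dec (inst σ (hmeta x args)) ≡ sub (plug d (map dec (instVec σ args))) (dec (σ x))
dec-inst-meta {ar = ar} {d = d} σ x args = trans (dec-hsub _ (σ x)) (sub-cong plugged (dec (σ x)))
  where
  plugged : ∀ i → dec ([ lookup (instVec σ args) , (λ y → hvar (d ↑ʳ y)) ]′ (splitAt (ar x) i))
                  ≡ plug d (map dec (instVec σ args)) i
  plugged i = trans ([,]-∘ dec (splitAt (ar x) i))
                    ([-,]-cong (λ a → sym (lookup-map a dec (instVec σ args))) (splitAt (ar x) i))

-- The instantiation lemma

liftSubst : ∀ {k n} d → (Fin k → Term n) → Fin (d + k) → Term (d + n)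
liftSubst {n = n} d θ = (λ i → var (i ↑ˡ n)) ++ᶠ (λ x → ren (d ↑ʳ_) (θ x))

liftSubst-bound : ∀ {k n} d (θ : Fin k → Term n) i → liftSubst d θ (i ↑ˡ k) ≡ var (i ↑ˡ n)
liftSubst-bound {n = n} d θ = lookup-++ˡ (λ i → var (i ↑ˡ n)) (λ x → ren (d ↑ʳ_) (θ x))

liftSubst-rule : ∀ {k n} d (θ : Fin k → Term n) x → liftSubst d θ (d ↑ʳ x) ≡ ren (d ↑ʳ_) (θ x)
liftSubst-rule {n = n} d θ = lookup-++ʳ (λ i → var (i ↑ˡ n)) (λ x → ren (d ↑ʳ_) (θ x))

liftSubst-extS : ∀ {k n} d (θ : Fin k → Term n) i → extS (liftSubst d θ) i ≡ liftSubst (suc d) θ i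
liftSubst-extS d θ zero    = refl
liftSubst-extS d θ (suc i) with splitAt d i
... | inj₁ _ = refl
... | inj₂ x = ren-∘ suc (d ↑ʳ_) (θ x)

liftSubst-zero : ∀ {k n} (θ : Fin k → Term n) i → liftSubst 0 θ i ≡ θ i
liftSubst-zero θ i = ren-id (λ _ → refl) (θ i)

Realises : (R : ∀ {m} → Rel (Term m) 0ℓ) {k n : ℕ} {ar : Fin k → ℕ} →
           (Fin k → Term n) → HSubst ar n → Set
Realises R {n = n} {ar} θ σ =
  ∀ {d} x {vs ws : Vec (Term (d + n)) (ar x)} →
  Pointwise R vs ws → R (apps (ren (d ↑ʳ_) (θ x)) vs) (sub (plug d ws) (dec (σ x)))

module Instantiation {R : ∀ {m} → Rel (Term m) 0ℓ} (compatible : Compatible R)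
                     {k n} {ar : Fin k → ℕ} (θ : Fin k → Term n) (σ : HSubst ar n)
                     (realises : Realises R θ σ) where
  open Compatible compatible

  inst-sound    : ∀ {d} {s : Term (d + k)} (u : Uniform ar d s) →
                  R (sub (liftSubst d θ) s) (dec (inst σ (encV u)))
  inst-soundVec : ∀ {d j} {vs : Vec (Term (d + k)) j} (us : UniformVec ar d vs) →
                  Pointwise R (map (sub (liftSubst d θ)) vs) (map dec (instVec σ (encVVec us)))

  inst-sound {d} (u-var i) = reflexive (liftSubst-bound d θ i)
  inst-sound (u-con c)    = reflexive refl
  inst-sound u-Type       = reflexive refl
  inst-sound u-Kind       = reflexive refl
  inst-sound {d} (u-fv x {vs} us) =
    subst₂ R (sym spine) (sym (dec-inst-meta σ x (encVVec us))) (realises x (inst-soundVec us))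
    where
    spine : sub (liftSubst d θ) (apps (var (d ↑ʳ x)) vs) ≡ apps (ren (d ↑ʳ_) (θ x)) (map (sub (liftSubst d θ)) vs)
    spine = trans (sub-apps _ _ vs) (cong (λ h → apps h (map (sub (liftSubst d θ)) vs)) (liftSubst-rule d θ x))
  inst-sound (u-app _ p q) = app-cong (inst-sound p) (inst-sound q)
  inst-sound {d} (u-lam {t = t} p q) =
    lam-cong (inst-sound p) (subst (λ s → R s _) (sym (sub-cong (liftSubst-extS d θ) t)) (inst-sound q))
  inst-sound {d} (u-pi {B = B} p q) =
    pi-cong (inst-sound p) (subst (λ s → R s _) (sym (sub-cong (liftSubst-extS d θ) B)) (inst-sound q))

  inst-soundVec []       = []
  inst-soundVec (u ∷ us) = inst-sound u ∷ inst-soundVec us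

  inst-sound₀ : ∀ {l : Term k} (u : Uniform ar 0 l) → R (sub θ l) (dec (inst σ (encV u)))
  inst-sound₀ {l} u = subst (λ s → R s _) (sub-cong (liftSubst-zero θ) l) (inst-sound u)

-- Every βΓ-step is an HRS(βΓ)-step between the encodings

etaSubst : ∀ {k n} (ar : Fin k → ℕ) → (Fin k → Term n) → HSubst ar n
etaSubst {n = n} ar θ x = enc (apps (ren (ar x ↑ʳ_) (θ x)) (tabulate (λ i → var (i ↑ˡ n))))

etaSubst-realises : ∀ {k n} {ar : Fin k → ℕ} (θ : Fin k → Term n) → Realises _≡_ θ (etaSubst ar θ)
etaSubst-realises {n = n} {ar} θ {d} x {vs} {ws} vs≡ws = begin
    apps (ren (d ↑ʳ_) (θ x)) vs
  ≡⟨ cong (apps _) (Pointwise-≡⇒≡ vs≡ws) ⟩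
    apps (ren (d ↑ʳ_) (θ x)) ws
  ≡⟨ sym (cong₂ apps head args) ⟩
    apps (sub (plug d ws) (ren (ar x ↑ʳ_) (θ x))) (map (sub (plug d ws)) bound)
  ≡⟨ sym (sub-apps (plug d ws) _ bound) ⟩
    sub (plug d ws) (apps (ren (ar x ↑ʳ_) (θ x)) bound)
  ≡⟨ cong (sub (plug d ws)) (sym (dec-enc (apps (ren (ar x ↑ʳ_) (θ x)) bound))) ⟩
    sub (plug d ws) (dec (etaSubst ar θ x))
  ∎
  where
  open ≡-Reasoning
  bound : Vec (Term (ar x + n)) (ar x)
  bound = tabulate (λ i → var (i ↑ˡ n))
  head : sub (plug d ws) (ren (ar x ↑ʳ_) (θ x)) ≡ ren (d ↑ʳ_) (θ x)
  head = trans (sub-ren _ _ (θ x)) (trans (sub-cong (lookup-++ʳ (lookup ws) _) (θ x)) (sub-var (d ↑ʳ_) (θ x)))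
  args : map (sub (plug d ws)) bound ≡ ws
  args = trans (sym (tabulate-∘ _ _)) (trans (tabulate-cong (lookup-++ˡ (lookup ws) _)) (tabulate∘lookup ws))

encode-instance : ∀ {k n} {ar : Fin k → ℕ} {l : Term k} (u : Uniform ar 0 l) (θ : Fin k → Term n) →
                  inst (etaSubst ar θ) (encV u) ≡ enc (sub θ l)
encode-instance {ar = ar} u θ = enc-from-dec (sym (inst-sound₀ u))
  where open Instantiation ≡-compatible θ (etaSubst ar θ) (etaSubst-realises θ)

βSubst : ∀ {n} → Term n → Term (suc n) → Term n → HSubst βar n
βSubst A u v zero             = enc A
βSubst A u v (suc zero)       = enc u
βSubst A u v (suc (suc zero)) = enc v

module _ {n} (A : Term n) (u : Term (suc n)) (v : Term n) where
  private
    inst-meta : ∀ {d} x (args : Vec (HTerm βar d) (βar x)) →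
                dec (inst (βSubst A u v) (hmeta x args))
                  ≡ sub (plug d (map dec (instVec (βSubst A u v) args))) (dec (βSubst A u v x))
    inst-meta = dec-inst-meta (βSubst A u v)

    inst-X : dec (inst {d = 0} (βSubst A u v) (hmeta zero [])) ≡ A
    inst-X = trans (inst-meta {0} zero []) (trans (sub-id (λ _ → refl) (dec (enc A))) (dec-enc A))

    inst-Y : dec (inst {d = 1} (βSubst A u v) (hmeta (suc zero) (hvar zero ∷ []))) ≡ u
    inst-Y = trans (inst-meta {1} (suc zero) (hvar zero ∷ []))
                   (trans (sub-id (λ { zero → refl ; (suc i) → refl }) (dec (enc u))) (dec-enc u))

    inst-Z : dec (inst {d = 0} (βSubst A u v) (hmeta (suc (suc zero)) [])) ≡ v
    inst-Z = trans (inst-meta {0} (suc (suc zero)) []) (trans (sub-id (λ _ → refl) (dec (enc v))) (dec-enc v))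

  β-lhs : inst (βSubst A u v) (hlhs βHRule) ≡ enc (app (lam A u) v)
  β-lhs = enc-from-dec (cong₂ app (cong₂ lam inst-X inst-Y) inst-Z)

  β-rhs : inst (βSubst A u v) (hrhs βHRule) ≡ enc (sub0 u v)
  β-rhs = enc-from-dec (trans (inst-meta {0} (suc zero) (hmeta (suc (suc zero)) [] ∷ []))
                              (trans (sub-cong (λ { zero → inst-Z ; (suc i) → refl }) (dec (enc u)))
                                     (cong (λ t → sub0 t v) (dec-enc u))))

encode-step : ∀ Γ → All EncCond Γ → ∀ {n} {t u : Term n} → StepβΓ Γ t u → StepβΓβ Γ t u
encode-step Γ encodable (top (inj₁ (beta A u v))) =
  subst₂ (HStep (HRSβΓ Γ)) (β-lhs A u v) (β-rhs A u v) (top (rule βrule (βSubst A u v)))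
encode-step Γ encodable (top (inj₂ (rule ρ∈Γ θ))) with All.lookup encodable ρ∈Γ
... | ar , c = subst₂ (HStep (HRSβΓ Γ)) (encode-instance (unifL c) θ) (encode-instance (unifR c) θ)
                      (top (rule (encoded ρ∈Γ ar c) (etaSubst ar θ)))
encode-step Γ encodable (appL s) = appL (encode-step Γ encodable s)
encode-step Γ encodable (appR s) = appR (encode-step Γ encodable s)
encode-step Γ encodable (lamL s) = lamL (encode-step Γ encodable s)
encode-step Γ encodable (lamR s) = lamR (encode-step Γ encodable s)
encode-step Γ encodable (piL s)  = piL (encode-step Γ encodable s)
encode-step Γ encodable (piR s)  = piR (encode-step Γ encodable s)

-- Every HRS(βΓ)-step decodes to a βΓ-conversion

-- The λΠ-rule whose encoding is the β-rule of HRS(βΓ):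
-- (λx:X. Y x) Z → Y Z, with rule variables X, Y, Z.
βL : Term 3
βL = app (lam (var zero) (app (var (suc (suc zero))) (var zero))) (var (suc (suc zero)))

βR : Term 3
βR = app (var (suc zero)) (var (suc (suc zero)))

uβL : Uniform βar 0 βL
uβL = u-app (λ { (_ , ()) }) (u-lam (u-fv zero []) (u-fv (suc zero) (u-var zero ∷ []))) (u-fv (suc (suc zero)) [])

uβR : Uniform βar 0 βR
uβR = u-fv (suc zero) (u-fv (suc (suc zero)) [] ∷ [])

-- Reindexing for peeling the outermost λ off j+1 abstractions: the first
-- abstracted variable moves past the other j.
shift : ∀ j {m} → Fin (suc j + m) → Fin (j + suc m)
shift j {m} = (j ↑ʳ zero) ∷ᶠ ((_↑ˡ suc m) ++ᶠ (λ y → j ↑ʳ suc y))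

shift-plug : ∀ {j m p} (ws : Vec (Term p) j) (w : Term p) (ρ : Fin m → Term p) i →
             (lookup ws ++ᶠ (w ∷ᶠ ρ)) (shift j i) ≡ (lookup (w ∷ ws) ++ᶠ ρ) i
shift-plug ws w ρ zero = lookup-++ʳ (lookup ws) (w ∷ᶠ ρ) zero
shift-plug {j} ws w ρ (suc i) with splitAt j i
... | inj₁ a = lookup-++ˡ (lookup ws) (w ∷ᶠ ρ) a
... | inj₂ y = lookup-++ʳ (lookup ws) (w ∷ᶠ ρ) (suc y)

-- j nested abstractions over a body whose first j variables are the
-- abstracted ones, the first argument being bound by the outermost λ.
Lams : ∀ j {m} → Term (j + m) → Term m
Lams zero    M = M
Lams (suc j) M = lam Type (Lams j (ren (shift j) M))

lamSubst : ∀ {k n} (ar : Fin k → ℕ) → HSubst ar n → Fin k → Term n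
lamSubst ar σ x = Lams (ar x) (dec (σ x))

module Conversion (Γ : GlobalContext) where

  infix 4 _~_
  _~_ : ∀ {n} → Rel (Term n) 0ℓ
  t ~ u = Γ ⊢ t ≡βΓ u

  module ~-Reasoning {n : ℕ} = SetoidReasoning (EqClosure.setoid (StepβΓ Γ {n}))

  ~-compatible : Compatible _~_
  ~-compatible = record
    { reflexive = λ { refl → ε }
    ; app-cong  = λ p q → gmap (λ t → app t _) appL p ◅◅ gmap (app _) appR q
    ; lam-cong  = λ p q → gmap (λ A → lam A _) lamL p ◅◅ gmap (lam _) lamR q
    ; pi-cong   = λ p q → gmap (λ A → pi A _) piL p ◅◅ gmap (pi _) piR q
    }
  open Compatible ~-compatible

  β-conv : ∀ {n} (A : Term n) u v → app (lam A u) v ~ sub0 u v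
  β-conv A u v = return (top (inj₁ (beta A u v)))

  Lams-β : ∀ j {m p} (M : Term (j + m)) (ρ : Fin m → Term p) (ws : Vec (Term p) j) →
           apps (sub ρ (Lams j M)) ws ~ sub (lookup ws ++ᶠ ρ) M
  Lams-β zero    M ρ []       = ε
  Lams-β (suc j) {m} M ρ (w ∷ ws) = begin
      apps (app (lam Type (sub (extS ρ) (Lams j M'))) w) ws
    ≈⟨ apps-cong (β-conv Type (sub (extS ρ) (Lams j M')) w) (Pointwise.refl ε {ws}) ⟩
      apps (sub0 (sub (extS ρ) (Lams j M')) w) ws
    ≡⟨ cong (λ h → apps h ws) (sub0-extS ρ (Lams j M') w) ⟩
      apps (sub (w ∷ᶠ ρ) (Lams j M')) ws
    ≈⟨ Lams-β j M' (w ∷ᶠ ρ) ws ⟩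
      sub (lookup ws ++ᶠ (w ∷ᶠ ρ)) (ren (shift j) M)
    ≡⟨ trans (sub-ren _ (shift j) M) (sub-cong (shift-plug ws w ρ) M) ⟩
      sub (lookup (w ∷ ws) ++ᶠ ρ) M
    ∎
    where
    open ~-Reasoning
    M' : Term (j + suc m)
    M' = ren (shift j) M

  lamSubst-realises : ∀ {k n} (ar : Fin k → ℕ) (σ : HSubst ar n) → Realises _~_ (lamSubst ar σ) σ
  lamSubst-realises ar σ {d} x {ws = ws} vs~ws =
    apps-cong (reflexive (sym (sub-var (d ↑ʳ_) (lamSubst ar σ x)))) vs~ws
    ◅◅ Lams-β (ar x) (dec (σ x)) (λ y → var (d ↑ʳ y)) ws

  rule-conv : ∀ {k n} {ar : Fin k → ℕ} {l r : Term k} (ul : Uniform ar 0 l) (ur : Uniform ar 0 r) →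
              (∀ (θ : Fin k → Term n) → sub θ l ~ sub θ r) →
              (σ : HSubst ar n) → dec (inst σ (encV ul)) ~ dec (inst σ (encV ur))
  rule-conv {ar = ar} ul ur conv σ = symmetric _ (inst-sound₀ ul) ◅◅ conv (lamSubst ar σ) ◅◅ inst-sound₀ ur
    where open Instantiation ~-compatible (lamSubst ar σ) σ (lamSubst-realises ar σ)

  β-instance : ∀ {n} (θ : Fin 3 → Term n) → sub θ βL ~ sub θ βR
  β-instance θ = β-conv _ _ _ ◅◅ reflexive (sub0-extS θ (app (var (suc (suc zero))) (var zero)) _)

  decode-step : ∀ {n} {h h' : HTerm₀ n} → HStep (HRSβΓ Γ) h h' → dec h ~ dec h'
  decode-step (top (rule (encoded ρ∈Γ ar c) σ)) =
    rule-conv (unifL c) (unifR c) (λ θ → return (top (inj₂ (rule ρ∈Γ θ)))) σ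
  decode-step (top (rule βrule σ)) = rule-conv uβL uβR β-instance σ
  decode-step (appL s) = app-cong (decode-step s) ε
  decode-step (appR s) = app-cong ε (decode-step s)
  decode-step (lamL s) = lam-cong (decode-step s) ε
  decode-step (lamR s) = lam-cong ε (decode-step s)
  decode-step (piL s)  = pi-cong (decode-step s) ε
  decode-step (piR s)  = pi-cong ε (decode-step s)

  -- →βΓβ is already closed under contexts, since →HRS(βΓ) is.
  βΓβ-compatible : ∀ {n} {t u : Term n} → Ctx (StepβΓβ Γ) t u → StepβΓβ Γ t u
  βΓβ-compatible (top s)  = s
  βΓβ-compatible (appL s) = appL (βΓβ-compatible s)
  βΓβ-compatible (appR s) = appR (βΓβ-compatible s)
  βΓβ-compatible (lamL s) = lamL (βΓβ-compatible s)
  βΓβ-compatible (lamR s) = lamR (βΓβ-compatible s)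
  βΓβ-compatible (piL s)  = piL (βΓβ-compatible s)
  βΓβ-compatible (piR s)  = piR (βΓβ-compatible s)

  decode : ∀ {n} {t u : Term n} → Ctx (StepβΓβ Γ) t u → t ~ u
  decode {t = t} {u} s = subst₂ _~_ (dec-enc t) (dec-enc u) (decode-step (βΓβ-compatible s))

mainTheorem9 : (Γ : GlobalContext) → All EncCond Γ →
               (n : ℕ) (t u : Term n) → CongβΓβ Γ t u ⇔ (Γ ⊢ t ≡βΓ u)
-- congruence ⊆ ≡βΓ by decoding each step; ≡βΓ ⊆ congruence by encoding each step.
mainTheorem9 Γ encodable n t u =
  mk⇔ (decode ⋆) (EqClosure.map (λ s → top (encode-step Γ encodable s)))
  where open Conversion Γ
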